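{- If $J$ and $G$ are graphs, then for any vertex $w$ of $G$, \[ s(J,G^-_w)=\tilde{q}(J,V(G)\setminus\{w\};x^G,y)\big|_{y_u:=x^G_{uw}}, \] that is, $s(J,G^-_w)$ equals the value of $\tilde{q}(J,V(G)\setminus\{w\};x,y)$ at $x_e=x^G_e$ for all $e$ and $y_u=x^G_{uw}$ for all $u\in V(G)\setminus\{w\}$.
   Context: All graphs are finite and simple; $s(J,G)$ is the number of induced subgraphs of $G$ isomorphic to $J$, and $G^-_w$ is the subgraph of $G$ induced by the vertices different from $w$ and not adjacent to $w$. For a finite set $S$, $E(K_S)$ is the set of 2-element subsets of $S$, $R_S=\mathbb{R}[x_e \mid e\in E(K_S)]/\langle x_e^2-1\rangle$ (write $x_{ab}$ for $x_{\{a,b\}}$), and $R^\circ_S=R_S[y_v\mid v\in S]/\langle y_v^2-1\mid v\in S\rangle$. $\mathrm{inj}(A,B)$ is the set of injective maps $A\to B$; for an injection $\phi$ and edge $e=uv$, $x_{\phi(e)}$ means $x_{\phi(u)\phi(v)}$. For a graph $J$, $L\subseteq V(J)$ and set $S$, \[ \tilde{k}(J,L,S;x,y) = \sum_{\phi \in \mathrm{inj}(V(J),S)} \prod_{e\in E(J)} x_{\phi(e)} \prod_{u\in L}y_{\phi(u)}\in R^\circ_S. \] For a graph $J$, $K_J$ is the complete graph on $V(J)$, $\mathrm{Aut}(J)$ is the number of automorphisms of $J$, and for $E\subseteq E(K_J)$, $K_J[E]$ is the graph with vertex set $V(J)$ and edge set $E$. Define \[ \tilde{q}(J,S;x,y)=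 \frac{1}{2^{|E(K_J)|+|V(J)|}\,\mathrm{Aut}(J)} \sum_{V\subseteq V(J)}\ \sum_{E\subseteq E(K_J)} (-1)^{|V|+| E\setminus E(J)|}\, \tilde{k}(K_J[E],V,S;x,y). \] For a graph $G$ and a 2-subset $e$ of $V(G)$, $x^G_e=1$ if $e\in E(G)$ and $x^G_e=-1$ otherwise. -}

module Defs where

open import Data.Bool using (Bool; true; false; _∧_; _∨_; not; if_then_else_)
open import Data.Nat as ℕ using (ℕ; zero; suc)
open import Data.Integer as ℤ using (ℤ; +_)
open import Data.Fin using (Fin; zero; suc; _<?_)
open import Data.Fin.Properties using (_≟_)
open import Data.List using (List; []; _∷_; map; concatMap; allFin; filter; length; foldr; _++_)
open import Data.Bool.ListAction using (all; any)
open import Data.Vec using (Vec; []; _∷_; lookup)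
open import Data.Product using (_×_; _,_; proj₁; proj₂)
open import Data.Rational as ℚ using (ℚ)
open import Relation.Nullary.Decidable using (⌊_⌋)
open import Relation.Binary.PropositionalEquality using (_≡_)

record Graph (n : ℕ) : Set where
  field
    adj    : Fin n → Fin n → Bool
    sym    : ∀ i j → adj i j ≡ adj j i
    irrefl : ∀ i → adj i i ≡ false
open Graph public

_==_ : ∀ {n} → Fin n → Fin n → Bool
i == j = ⌊ i ≟ j ⌋

_⇔ᵇ_ : Bool → Bool → Bool
true  ⇔ᵇ b = b
false ⇔ᵇ b = not b

Subset : ℕ → Set
Subset n = Vec Bool n

_∈ˢ_ : ∀ {n} → Fin n → Subset n → Bool
i ∈ˢ U = lookup U i

allSubsets : (n : ℕ) → List (Subset n)
allSubsets zero    = [] ∷ []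
allSubsets (suc n) = concatMap (λ U → (false ∷ U) ∷ (true ∷ U) ∷ []) (allSubsets n)

cons : ∀ {m n} → Fin n → (Fin m → Fin n) → Fin (suc m) → Fin n
cons k f zero    = k
cons k f (suc i) = f i

allMaps : (m n : ℕ) → List (Fin m → Fin n)
allMaps zero    n = (λ ()) ∷ []
allMaps (suc m) n = concatMap (λ f → map (λ k → cons k f) (allFin n)) (allMaps m n)

sublists : ∀ {A : Set} → List A → List (List A)
sublists []       = [] ∷ []
sublists (a ∷ as) = let r = sublists as in r ++ map (a ∷_) r

count : ∀ {A : Set} → (A → Bool) → List A → ℕ
count p xs = length (filter (λ a → p a Data.Bool.≟ true) xs)
  where import Data.Bool

isInjective : ∀ {m n} → (Fin m → Fin n) → Bool
isInjective {m} f = all (λ i → all (λ j → (i == j) ∨ not (f i == f j)) (allFin m)) (allFin m)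

isSurjective : ∀ {m n} → (Fin m → Fin n) → Bool
isSurjective {m} {n} f = all (λ k → any (λ i → f i == k) (allFin m)) (allFin n)

preservesAdj : ∀ {m n} → Graph m → Graph n → (Fin m → Fin n) → Bool
preservesAdj {m} J G f =
  all (λ i → all (λ j → adj J i j ⇔ᵇ adj G (f i) (f j)) (allFin m)) (allFin m)

-- s(J, G[W]): the number of induced subgraphs of G[W] isomorphic to J,
-- i.e. the number of vertex sets U ⊆ W such that G[U] ≅ J
-- (there is a bijection Fin m → U preserving and reflecting adjacency).

_⊆ᵇ_ : ∀ {n} → Subset n → Subset n → Bool
_⊆ᵇ_ {n} U W = all (λ k → not (k ∈ˢ U) ∨ (k ∈ˢ W)) (allFin n)

imageIs : ∀ {m n} → (Fin m → Fin n) → Subset n → Bool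
imageIs {m} {n} f U = all (λ k → (k ∈ˢ U) ⇔ᵇ any (λ i → f i == k) (allFin m)) (allFin n)

inducedIso : ∀ {m n} → Graph m → Graph n → Subset n → Bool
inducedIso {m} {n} J G U =
  any (λ f → isInjective f ∧ imageIs f U ∧ preservesAdj J G f) (allMaps m n)

sInd : ∀ {m n} → Graph m → Graph n → Subset n → ℕ
sInd {m} {n} J G W = count (λ U → (U ⊆ᵇ W) ∧ inducedIso J G U) (allSubsets n)

-- G^-_w : vertex set of the subgraph of G induced by the vertices
-- different from w and not adjacent to w.
minusNbhd : ∀ {n} → Graph n → Fin n → Subset n
minusNbhd {n} G w = Data.Vec.tabulate (λ v → not (v == w) ∧ not (adj G w v))
  where import Data.Vec

allBut : ∀ {n} → Fin n → Subset n
allBut w = Data.Vec.tabulate (λ v → not (v == w))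
  where import Data.Vec

autCount : ∀ {m} → Graph m → ℕ
autCount {m} J =
  count (λ f → isInjective f ∧ isSurjective f ∧ preservesAdj J J f) (allMaps m m)

-- E(K_J) for J on Fin m: the 2-subsets {i,j}, represented as pairs i < j.

edgesK : (m : ℕ) → List (Fin m × Fin m)
edgesK m = concatMap (λ i → map (λ j → (i , j)) (filter (λ j → i <? j) (allFin m))) (allFin m)

negOnePow : ℕ → ℤ
negOnePow zero    = + 1
negOnePow (suc k) = ℤ.- negOnePow k

prodℤ : List ℤ → ℤ
prodℤ = foldr ℤ._*_ (+ 1)

sumℤ : List ℤ → ℤ
sumℤ = foldr ℤ._+_ (+ 0)

-- An element of R°_S (multilinear in ±1-valued variables) is the same as
-- a function of the ±1 values of its variables; the statement only uses
-- the evaluation at x_e = x^G_e, y_u = x^G_{uw}, so we define the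
-- evaluation directly.  Variables x_{ab} are given by a function
-- x : Fin n → Fin n → ℤ (used only at a ≠ b; symmetric in our use),
-- and y : Fin n → ℤ.

injInto : ∀ {m n} → Subset n → List (Fin m → Fin n)
injInto {m} {n} S =
  filter (λ φ → (isInjective φ ∧ all (λ u → φ u ∈ˢ S) (allFin m)) Data.Bool.≟ true) (allMaps m n)
  where import Data.Bool

-- k̃(K_J[E], L, S; x, y) evaluated, where the graph K_J[E] on Fin m has
-- edge set E (a list of pairs i < j) and L ⊆ V(J).
kTilde : ∀ {m n} → List (Fin m × Fin m) → Subset m → Subset n →
         (Fin n → Fin n → ℤ) → (Fin n → ℤ) → ℤ
kTilde {m} E L S x y =
  sumℤ (map (λ φ →
    prodℤ (map (λ e → x (φ (proj₁ e)) (φ (proj₂ e))) E) ℤ.*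
    prodℤ (map (λ u → if u ∈ˢ L then y (φ u) else + 1) (allFin m)))
    (injInto {m} S))

-- 1/d in ℚ (d is always nonzero where used: d = 2^k · Aut(J) ≥ 1)
invℕ : ℕ → ℚ
invℕ zero    = ℚ.0ℚ
invℕ (suc d) = (+ 1) ℚ./ (suc d)

sizeˢ : ∀ {m} → Subset m → ℕ
sizeˢ {m} V = count (λ u → u ∈ˢ V) (allFin m)

qTilde : ∀ {m n} → Graph m → Subset n →
         (Fin n → Fin n → ℤ) → (Fin n → ℤ) → ℚ
qTilde {m} J S x y =
  invℕ (2 ℕ.^ (length (edgesK m) ℕ.+ m) ℕ.* autCount J) ℚ.*
  (ℚ._/_ (sumℤ (concatMap (λ V → map (λ E →
      negOnePow (sizeˢ V ℕ.+ count (λ e → not (adj J (proj₁ e) (proj₂ e))) E)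
        ℤ.* kTilde E V S x y)
      (sublists (edgesK m))) (allSubsets m))) 1)

xG : ∀ {n} → Graph n → Fin n → Fin n → ℤ
xG G a b = if adj G a b then + 1 else ℤ.-[1+ 0 ]

module Submission where

-- Expanding k̃ as a sum over injections φ : V(J) → V(G) ∖ {w} and exchanging
-- the order of summation, the signed sum in q̃ becomes
--   ∑_φ (∑_{E ⊆ E(K_J)} ± ∏_{e ∈ E} x_{φ(e)}) · (∑_{V ⊆ V(J)} (-1)^|V| ∏_{u ∈ V} y_{φ(u)})
--   = ∑_φ ∏_{e ∈ E(K_J)} (1 ± x_{φ(e)}) · ∏_{u ∈ V(J)} (1 - y_{φ(u)}).
-- A pair factor is 2 when J and G agree on e and φ(e), and 0 otherwise; a vertex
-- factor is 2 when φ(u) is not adjacent to w, and 0 otherwise.  Hence the signed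
-- sum is 2^{|E(K_J)| + |V(J)|} times the number of induced embeddings of J into
-- G⁻_w, and by orbit counting every induced copy of J is the image of exactly
-- Aut(J) embeddings.  Dividing by the normalisation 2^{|E(K_J)| + |V(J)|} Aut(J)
-- (which is ≥ 1 since the identity is an automorphism) gives the theorem.

open import Defs
open import Data.Nat using (ℕ)
open import Data.Fin using (Fin)
open import Data.Integer using (+_)
open import Data.Rational using (_/_)
open import Relation.Binary.PropositionalEquality using (_≡_)

import Data.Bool as Bool
open import Data.Bool using (Bool; true; false; T; _∧_; _∨_; not; if_then_else_)
open import Data.Bool.ListAction using (all; any)
open import Data.Empty using (⊥-elim)
open import Data.Fin using (zero; suc; _<_; _<?_)
import Data.Fin.Properties as Fin
open import Data.Fin.Properties using (<-cmp; any?; _≟_)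
open import Data.Integer using (ℤ; _+_; _*_; -_; -[1+_])
import Data.Integer.Properties as ℤP
open import Data.Integer.Solver using (module +-*-Solver)
open +-*-Solver using (solve; _:+_; _:*_; _:=_; :-_; con)
open import Data.List using (List; []; _∷_; map; concatMap; allFin; filter; tabulate; _++_; length)
import Data.List.Properties as ListP
open import Data.List.Membership.Propositional using (_∈_; lose)
open import Data.List.Membership.Propositional.Properties
  using (∈-allFin; ∈-concatMap⁺; ∈-concatMap⁻; ∈-map⁺; ∈-map⁻; ∈-filter⁺; ∈-filter⁻)
import Data.List.Relation.Unary.All as All
open import Data.List.Relation.Unary.All.Properties using (all⁺; all⁻; tabulate⁺)
import Data.List.Relation.Unary.Any as Any
open import Data.List.Relation.Unary.Any.Properties using (any⁺; any⁻)
open import Data.Nat using (zero; suc)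
import Data.Nat as ℕ
import Data.Nat.Properties as ℕP
open import Data.Product using (_×_; _,_; proj₁; proj₂; ∃)
import Data.Rational as ℚ
open import Data.Rational using (toℚᵘ)
open import Data.Rational.Properties using (toℚᵘ-injective; toℚᵘ-homo-*; toℚᵘ-fromℚᵘ)
open import Data.Rational.Unnormalised as ℚᵘ using (mkℚᵘ; *≡*)
import Data.Rational.Unnormalised.Properties as ℚᵘP
import Data.Vec
open import Data.Vec using ([]; _∷_; lookup)
import Data.Vec.Properties as Vec
open import Function using (_∘_; id)
open import Function.Definitions using (Injective)
open import Relation.Binary.Definitions using (tri<; tri≈; tri>)
open import Relation.Binary.PropositionalEquality
  using (refl; trans; cong; cong₂; subst; module ≡-Reasoning)
  renaming (sym to ≡-sym)
open import Relation.Nullary using (yes; no)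
open import Relation.Nullary.Decidable using (toWitness; fromWitness)

⇔ᵇ⁻ : ∀ {a b} → T (a ⇔ᵇ b) → a ≡ b
⇔ᵇ⁻ {true}  {true}  _ = refl
⇔ᵇ⁻ {false} {false} _ = refl

⇔ᵇ⁺ : ∀ {a b} → a ≡ b → T (a ⇔ᵇ b)
⇔ᵇ⁺ {true}  refl = _
⇔ᵇ⁺ {false} refl = _

∧⁺ : ∀ {a b} → T a → T b → T (a ∧ b)
∧⁺ {true} _ tb = tb

∧⁻ : ∀ {a b} → T (a ∧ b) → T a × T b
∧⁻ {true} tb = _ , tb

implies⁻ : ∀ {a b} → T (not a ∨ b) → T a → T b
implies⁻ {true} tb _ = tb

implies⁺ : ∀ {a b} → (T a → T b) → T (not a ∨ b)
implies⁺ {false} _ = _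
implies⁺ {true}  f = f _

implied⁻ : ∀ {a b} → T (a ∨ not b) → T b → T a
implied⁻ {true}            _ _ = _
implied⁻ {false} {false}   _ ()

implied⁺ : ∀ {a b} → (T b → T a) → T (a ∨ not b)
implied⁺ {true}          _ = _
implied⁺ {false} {false} _ = _
implied⁺ {false} {true}  f = f _

T-ext : ∀ {a b} → (T a → T b) → (T b → T a) → a ≡ b
T-ext {false} {false} _ _ = refl
T-ext {false} {true}  _ g = ⊥-elim (g _)
T-ext {true}  {false} f _ = ⊥-elim (f _)
T-ext {true}  {true}  _ _ = refl

==⁻ : ∀ {n} {i j : Fin n} → T (i == j) → i ≡ j
==⁻ = toWitness

==⁺ : ∀ {n} {i j : Fin n} → i ≡ j → T (i == j)
==⁺ = fromWitness

all-allFin⁻ : ∀ {m} (p : Fin m → Bool) → T (all p (allFin m)) → ∀ i → T (p i)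
all-allFin⁻ p h i = All.lookup (all⁺ p (allFin _) h) (∈-allFin i)

all-allFin⁺ : ∀ {m} (p : Fin m → Bool) → (∀ i → T (p i)) → T (all p (allFin m))
all-allFin⁺ p h = all⁻ p (tabulate⁺ h)

all²⁻ : ∀ {m} (p : Fin m → Fin m → Bool) →
        T (all (λ i → all (p i) (allFin m)) (allFin m)) → ∀ i j → T (p i j)
all²⁻ p h i = all-allFin⁻ (p i) (all-allFin⁻ (λ i → all (p i) (allFin _)) h i)

all²⁺ : ∀ {m} (p : Fin m → Fin m → Bool) →
        (∀ i j → T (p i j)) → T (all (λ i → all (p i) (allFin m)) (allFin m))
all²⁺ p h = all-allFin⁺ (λ i → all (p i) (allFin _)) λ i → all-allFin⁺ (p i) (h i)

any-witness : ∀ {A : Set} (p : A → Bool) (xs : List A) → T (any p xs) → ∃ λ x → T (p x)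
any-witness p xs h = Any.satisfied (any⁻ p xs h)

any-allFin⁺ : ∀ {m} (p : Fin m → Bool) (i : Fin m) → T (p i) → T (any p (allFin m))
any-allFin⁺ p i h = any⁺ p (lose (∈-allFin i) h)

module _ {m n : ℕ} {f : Fin m → Fin n} where

  isInjective⁻ : T (isInjective f) → Injective _≡_ _≡_ f
  isInjective⁻ h {i} {j} fi≡fj =
    ==⁻ (implied⁻ {i == j} (all²⁻ (λ i j → (i == j) ∨ not (f i == f j)) h i j) (==⁺ fi≡fj))

  isInjective⁺ : Injective _≡_ _≡_ f → T (isInjective f)
  isInjective⁺ inj =
    all²⁺ (λ i j → (i == j) ∨ not (f i == f j)) λ i j → implied⁺ (λ t → ==⁺ (inj (==⁻ t)))

  isSurjective⁻ : T (isSurjective f) → ∀ k → ∃ λ i → f i ≡ k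
  isSurjective⁻ h k with any-witness _ (allFin m) (all-allFin⁻ (λ k → any (λ i → f i == k) (allFin m)) h k)
  ... | i , t = i , ==⁻ t

  isSurjective⁺ : (∀ k → ∃ λ i → f i ≡ k) → T (isSurjective f)
  isSurjective⁺ s = all-allFin⁺ (λ k → any (λ i → f i == k) (allFin m))
    λ k → any-allFin⁺ (λ i → f i == k) (proj₁ (s k)) (==⁺ (proj₂ (s k)))

  preservesAdj⁻ : {J : Graph m} {G : Graph n} →
                  T (preservesAdj J G f) → ∀ i j → adj J i j ≡ adj G (f i) (f j)
  preservesAdj⁻ {J} {G} h i j = ⇔ᵇ⁻ (all²⁻ (λ i j → adj J i j ⇔ᵇ adj G (f i) (f j)) h i j)

  preservesAdj⁺ : {J : Graph m} {G : Graph n} →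
                  (∀ i j → adj J i j ≡ adj G (f i) (f j)) → T (preservesAdj J G f)
  preservesAdj⁺ {J} {G} p = all²⁺ (λ i j → adj J i j ⇔ᵇ adj G (f i) (f j)) λ i j → ⇔ᵇ⁺ (p i j)

module _ {m n : ℕ} (f : Fin m → Fin n) where

  image : Subset n
  image = Data.Vec.tabulate (λ k → any (λ i → f i == k) (allFin m))

  ∈-image⁻ : ∀ {k} → T (k ∈ˢ image) → ∃ λ i → f i ≡ k
  ∈-image⁻ {k} h with any-witness _ (allFin m) (subst T (Vec.lookup∘tabulate _ k) h)
  ... | i , t = i , ==⁻ t

  ∈-image⁺ : ∀ i → T (f i ∈ˢ image)
  ∈-image⁺ i = subst T (≡-sym (Vec.lookup∘tabulate _ (f i))) (any-allFin⁺ _ i (==⁺ refl))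

  imageIs⁻ : ∀ {U} → T (imageIs f U) → ∀ k → lookup U k ≡ lookup image k
  imageIs⁻ {U} h k =
    trans (⇔ᵇ⁻ (all-allFin⁻ (λ k → (k ∈ˢ U) ⇔ᵇ any (λ i → f i == k) (allFin m)) h k))
          (≡-sym (Vec.lookup∘tabulate _ k))

  imageIs⁺ : ∀ {U} → (∀ k → lookup U k ≡ lookup image k) → T (imageIs f U)
  imageIs⁺ {U} e = all-allFin⁺ (λ k → (k ∈ˢ U) ⇔ᵇ any (λ i → f i == k) (allFin m))
    λ k → ⇔ᵇ⁺ (trans (e k) (Vec.lookup∘tabulate _ k))

  imageIs-spec⁻ : ∀ {U} → T (imageIs f U) →
                  (∀ i → T (f i ∈ˢ U)) × (∀ k → T (k ∈ˢ U) → ∃ λ i → f i ≡ k)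
  imageIs-spec⁻ {U} h =
      (λ i → subst T (≡-sym (imageIs⁻ {U} h (f i))) (∈-image⁺ i))
    , (λ k k∈U → ∈-image⁻ (subst T (imageIs⁻ {U} h k) k∈U))

  imageIs-spec⁺ : ∀ {U} → (∀ i → T (f i ∈ˢ U)) → (∀ k → T (k ∈ˢ U) → ∃ λ i → f i ≡ k) →
                  T (imageIs f U)
  imageIs-spec⁺ {U} inside onto = imageIs⁺ {U} λ k → T-ext
    (λ k∈U → let (i , fi≡k) = onto k k∈U in subst (λ z → T (z ∈ˢ image)) fi≡k (∈-image⁺ i))
    (λ k∈im → let (i , fi≡k) = ∈-image⁻ k∈im in subst (λ z → T (z ∈ˢ U)) fi≡k (inside i))

⊆ᵇ⁻ : ∀ {n} {U W : Subset n} → T (U ⊆ᵇ W) → ∀ k → T (k ∈ˢ U) → T (k ∈ˢ W)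
⊆ᵇ⁻ h k = implies⁻ (all-allFin⁻ _ h k)

⊆ᵇ⁺ : ∀ {n} {U W : Subset n} → (∀ k → T (k ∈ˢ U) → T (k ∈ˢ W)) → T (U ⊆ᵇ W)
⊆ᵇ⁺ s = all-allFin⁺ _ λ k → implies⁺ (s k)

∈-edgesK⁺ : ∀ {m} {i j : Fin m} → i < j → (i , j) ∈ edgesK m
∈-edgesK⁺ {m} {i} {j} i<j =
  ∈-concatMap⁺ _ {xs = allFin m} (lose (∈-allFin i) (∈-map⁺ _ (∈-filter⁺ (i <?_) (∈-allFin j) i<j)))

∈-edgesK⁻ : ∀ {m} {e : Fin m × Fin m} → e ∈ edgesK m → proj₁ e < proj₂ e
∈-edgesK⁻ {m} h with Any.satisfied (∈-concatMap⁻ (λ i → map (i ,_) (filter (i <?_) (allFin m))) {xs = allFin m} h)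
... | i , e∈ with ∈-map⁻ (i ,_) e∈
... | j , j∈ , refl = proj₂ (∈-filter⁻ (i <?_) {xs = allFin m} j∈)

all-edgesK⁻ : ∀ {m} (b : Fin m × Fin m → Bool) →
              T (all b (edgesK m)) → ∀ i j → i < j → T (b (i , j))
all-edgesK⁻ b h i j i<j = All.lookup (all⁺ b (edgesK _) h) (∈-edgesK⁺ i<j)

all-edgesK⁺ : ∀ {m} (b : Fin m × Fin m → Bool) →
              (∀ i j → i < j → T (b (i , j))) → T (all b (edgesK m))
all-edgesK⁺ b h = all⁻ b (All.tabulate λ {e} e∈ → h (proj₁ e) (proj₂ e) (∈-edgesK⁻ e∈))

-- Adjacency is symmetric and irreflexive, so a map preserving it on the
-- pairs i < j preserves it on all pairs.
preserves-from-pairs : ∀ {m n} (J : Graph m) (G : Graph n) (f : Fin m → Fin n) →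
  (∀ i j → i < j → adj J i j ≡ adj G (f i) (f j)) → ∀ i j → adj J i j ≡ adj G (f i) (f j)
preserves-from-pairs J G f h i j with <-cmp i j
... | tri< i<j _ _  = h i j i<j
... | tri≈ _ refl _ = trans (irrefl J i) (≡-sym (irrefl G (f i)))
... | tri> _ _ j<i  = trans (Graph.sym J i j) (trans (h j i j<i) (Graph.sym G (f j) (f i)))

record IsIsoOnto {m n} (J : Graph m) (G : Graph n) (U : Subset n) (f : Fin m → Fin n) : Set where
  field
    injective : Injective _≡_ _≡_ f
    inside    : ∀ i → T (f i ∈ˢ U)
    onto      : ∀ k → T (k ∈ˢ U) → ∃ λ i → f i ≡ k
    preserves : ∀ i j → adj J i j ≡ adj G (f i) (f j)

isoOnto : ∀ {m n} → Graph m → Graph n → Subset n → (Fin m → Fin n) → Bool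
isoOnto J G U f = isInjective f ∧ imageIs f U ∧ preservesAdj J G f

isoOnto⁻ : ∀ {m n} {J : Graph m} {G : Graph n} {U f} → T (isoOnto J G U f) → IsIsoOnto J G U f
isoOnto⁻ {J = J} {G} {U} {f} h = record
  { injective = isInjective⁻ {f = f} inj
  ; inside    = proj₁ (imageIs-spec⁻ f {U} img)
  ; onto      = proj₂ (imageIs-spec⁻ f {U} img)
  ; preserves = preservesAdj⁻ {f = f} {J} {G} pres
  }
  where
  inj : T (isInjective f)
  inj = proj₁ (∧⁻ {isInjective f} h)
  img : T (imageIs f U)
  img = proj₁ (∧⁻ {imageIs f U} (proj₂ (∧⁻ {isInjective f} h)))
  pres : T (preservesAdj J G f)
  pres = proj₂ (∧⁻ {imageIs f U} (proj₂ (∧⁻ {isInjective f} h)))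

isoOnto⁺ : ∀ {m n} {J : Graph m} {G : Graph n} {U f} → IsIsoOnto J G U f → T (isoOnto J G U f)
isoOnto⁺ {J = J} {G} {U} {f} iso = ∧⁺ (isInjective⁺ injective)
  (∧⁺ (imageIs-spec⁺ f {U} inside onto) (preservesAdj⁺ {f = f} {J} {G} preserves))
  where open IsIsoOnto iso

record IsAutomorphism {m} (J : Graph m) (σ : Fin m → Fin m) : Set where
  field
    injective  : Injective _≡_ _≡_ σ
    surjective : ∀ k → ∃ λ i → σ i ≡ k
    preserves  : ∀ i j → adj J i j ≡ adj J (σ i) (σ j)

isAutomorphism : ∀ {m} → Graph m → (Fin m → Fin m) → Bool
isAutomorphism J σ = isInjective σ ∧ isSurjective σ ∧ preservesAdj J J σ

isAutomorphism⁻ : ∀ {m} {J : Graph m} {σ} → T (isAutomorphism J σ) → IsAutomorphism J σ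
isAutomorphism⁻ {J = J} {σ} h = record
  { injective  = isInjective⁻ {f = σ} (proj₁ (∧⁻ {isInjective σ} h))
  ; surjective = isSurjective⁻ {f = σ} (proj₁ (∧⁻ {isSurjective σ} (proj₂ (∧⁻ {isInjective σ} h))))
  ; preserves  = preservesAdj⁻ {f = σ} {J} {J} (proj₂ (∧⁻ {isSurjective σ} (proj₂ (∧⁻ {isInjective σ} h))))
  }

isAutomorphism⁺ : ∀ {m} {J : Graph m} {σ} → IsAutomorphism J σ → T (isAutomorphism J σ)
isAutomorphism⁺ {J = J} {σ} aut =
  ∧⁺ (isInjective⁺ injective) (∧⁺ (isSurjective⁺ surjective) (preservesAdj⁺ {f = σ} {J} {J} preserves))
  where open IsAutomorphism aut

record IsEmbeddingInto {m n} (J : Graph m) (G : Graph n) (M : Subset n) (f : Fin m → Fin n) : Set where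
  field
    injective : Injective _≡_ _≡_ f
    preserves : ∀ i j → adj J i j ≡ adj G (f i) (f j)
    inside    : ∀ i → T (f i ∈ˢ M)

embedsInto : ∀ {m n} → Graph m → Graph n → Subset n → (Fin m → Fin n) → Bool
embedsInto {m} J G M f = isInjective f ∧ preservesAdj J G f ∧ all (λ i → f i ∈ˢ M) (allFin m)

embedsInto⁻ : ∀ {m n} {J : Graph m} {G : Graph n} {M f} → T (embedsInto J G M f) → IsEmbeddingInto J G M f
embedsInto⁻ {J = J} {G} {M} {f} h = record
  { injective = isInjective⁻ {f = f} (proj₁ (∧⁻ {isInjective f} h))
  ; preserves = preservesAdj⁻ {f = f} {J} {G} (proj₁ (∧⁻ {preservesAdj J G f} (proj₂ (∧⁻ {isInjective f} h))))
  ; inside    = all-allFin⁻ (λ i → f i ∈ˢ M) (proj₂ (∧⁻ {preservesAdj J G f} (proj₂ (∧⁻ {isInjective f} h))))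
  }

embedsInto⁺ : ∀ {m n} {J : Graph m} {G : Graph n} {M f} → IsEmbeddingInto J G M f → T (embedsInto J G M f)
embedsInto⁺ {J = J} {G} {M} {f} emb =
  ∧⁺ (isInjective⁺ injective)
     (∧⁺ (preservesAdj⁺ {f = f} {J} {G} preserves) (all-allFin⁺ (λ i → f i ∈ˢ M) inside))
  where open IsEmbeddingInto emb

-- Fix an isomorphism f₀ from J onto G[U].  The isomorphisms from J onto G[U]
-- are exactly the maps f₀ ∘ σ with σ an automorphism of J, and σ is
-- determined by the isomorphism as f₀⁻¹ ∘ φ.
module IsomorphismsOnto {m n} {J : Graph m} {G : Graph n} {U : Subset n}
                        {f₀ : Fin m → Fin n} (iso₀ : IsIsoOnto J G U f₀) where

  open IsIsoOnto iso₀ using () renaming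
    (injective to inj₀; inside to inside₀; onto to onto₀; preserves to preserves₀)

  -- The inverse of f₀ on U; outside U it returns the default d.
  preimage : Fin m → Fin n → Fin m
  preimage d k with any? (λ j → f₀ j ≟ k)
  ... | yes (j , _) = j
  ... | no _        = d

  preimage-correct : ∀ d {k} → T (k ∈ˢ U) → f₀ (preimage d k) ≡ k
  preimage-correct d {k} k∈U with any? (λ j → f₀ j ≟ k)
  ... | yes (_ , f₀j≡k) = f₀j≡k
  ... | no ∄j           = ⊥-elim (∄j (onto₀ k k∈U))

  iso-from-aut : ∀ {σ φ} → IsAutomorphism J σ → (∀ i → φ i ≡ f₀ (σ i)) → IsIsoOnto J G U φ
  iso-from-aut {σ} {φ} aut φ≗f₀σ = record
    { injective = λ {i} {j} φi≡φj →
        injective (inj₀ (trans (≡-sym (φ≗f₀σ i)) (trans φi≡φj (φ≗f₀σ j))))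
    ; inside    = λ i → subst (λ z → T (z ∈ˢ U)) (≡-sym (φ≗f₀σ i)) (inside₀ (σ i))
    ; onto      = λ k k∈U →
        let (i , f₀i≡k) = onto₀ k k∈U ; (i′ , σi′≡i) = surjective i
        in i′ , trans (φ≗f₀σ i′) (trans (cong f₀ σi′≡i) f₀i≡k)
    ; preserves = λ i j → trans (preserves i j)
        (trans (preserves₀ (σ i) (σ j)) (≡-sym (cong₂ (adj G) (φ≗f₀σ i) (φ≗f₀σ j))))
    }
    where open IsAutomorphism aut

  aut-from-iso : ∀ {σ φ} → IsIsoOnto J G U φ → (∀ i → φ i ≡ f₀ (σ i)) → IsAutomorphism J σ
  aut-from-iso {σ} {φ} iso φ≗f₀σ = record
    { injective  = λ {i} {j} σi≡σj →
        injective (trans (φ≗f₀σ i) (trans (cong f₀ σi≡σj) (≡-sym (φ≗f₀σ j))))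
    ; surjective = λ k →
        let (i , φi≡f₀k) = onto (f₀ k) (inside₀ k) in i , inj₀ (trans (≡-sym (φ≗f₀σ i)) φi≡f₀k)
    ; preserves  = λ i j → trans (preserves i j)
        (trans (cong₂ (adj G) (φ≗f₀σ i) (φ≗f₀σ j)) (≡-sym (preserves₀ (σ i) (σ j))))
    }
    where open IsIsoOnto iso

  factor⁻ : ∀ {φ : Fin m → Fin n} → IsIsoOnto J G U φ → (σ : Fin m → Fin m) →
            (∀ i → φ i ≡ f₀ (σ i)) → ∀ i → σ i ≡ preimage i (φ i)
  factor⁻ iso σ φ≗f₀σ i =
    inj₀ (trans (≡-sym (φ≗f₀σ i)) (≡-sym (preimage-correct i (IsIsoOnto.inside iso i))))

  factor⁺ : ∀ {φ : Fin m → Fin n} → IsIsoOnto J G U φ → (σ : Fin m → Fin m) →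
            (∀ i → σ i ≡ preimage i (φ i)) → ∀ i → φ i ≡ f₀ (σ i)
  factor⁺ iso σ σ≗ i =
    trans (≡-sym (preimage-correct i (IsIsoOnto.inside iso i))) (cong f₀ (≡-sym (σ≗ i)))

∑ : {A : Set} → List A → (A → ℤ) → ℤ
∑ xs h = sumℤ (map h xs)

⟦_⟧ : Bool → ℤ
⟦ true  ⟧ = + 1
⟦ false ⟧ = + 0

⟦∧⟧ : ∀ a b → ⟦ a ∧ b ⟧ ≡ ⟦ a ⟧ * ⟦ b ⟧
⟦∧⟧ true  true  = refl
⟦∧⟧ true  false = refl
⟦∧⟧ false _     = refl

sumℤ-++ : ∀ (l₁ l₂ : List ℤ) → sumℤ (l₁ ++ l₂) ≡ sumℤ l₁ + sumℤ l₂
sumℤ-++ []       l₂ = ≡-sym (ℤP.+-identityˡ _)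
sumℤ-++ (z ∷ l₁) l₂ = trans (cong (_+_ z) (sumℤ-++ l₁ l₂)) (≡-sym (ℤP.+-assoc z _ _))

module _ {A : Set} where

  ∑-cong : ∀ (xs : List A) {f g : A → ℤ} → (∀ x → f x ≡ g x) → ∑ xs f ≡ ∑ xs g
  ∑-cong []       _ = refl
  ∑-cong (x ∷ xs) e = cong₂ _+_ (e x) (∑-cong xs e)

  ∑-zero : ∀ (xs : List A) → ∑ xs (λ _ → + 0) ≡ + 0
  ∑-zero []       = refl
  ∑-zero (x ∷ xs) = trans (ℤP.+-identityˡ _) (∑-zero xs)

  ∑-+ : ∀ (xs : List A) (f g : A → ℤ) → ∑ xs (λ x → f x + g x) ≡ ∑ xs f + ∑ xs g
  ∑-+ []       f g = refl
  ∑-+ (x ∷ xs) f g = trans (cong (_+_ (f x + g x)) (∑-+ xs f g))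
    (solve 4 (λ a b c d → (a :+ b) :+ (c :+ d) := (a :+ c) :+ (b :+ d)) refl (f x) (g x) (∑ xs f) (∑ xs g))

  ∑-*ˡ : ∀ (c : ℤ) (xs : List A) (f : A → ℤ) → c * ∑ xs f ≡ ∑ xs (λ x → c * f x)
  ∑-*ˡ c []       f = ℤP.*-zeroʳ c
  ∑-*ˡ c (x ∷ xs) f = trans (ℤP.*-distribˡ-+ c (f x) _) (cong (_+_ (c * f x)) (∑-*ˡ c xs f))

  ∑-*ʳ : ∀ (xs : List A) (f : A → ℤ) (c : ℤ) → ∑ xs f * c ≡ ∑ xs (λ x → f x * c)
  ∑-*ʳ []       f c = ℤP.*-zeroˡ c
  ∑-*ʳ (x ∷ xs) f c = trans (ℤP.*-distribʳ-+ c (f x) _) (cong (_+_ (f x * c)) (∑-*ʳ xs f c))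

  ∑-++ : ∀ (xs ys : List A) (h : A → ℤ) → ∑ (xs ++ ys) h ≡ ∑ xs h + ∑ ys h
  ∑-++ xs ys h = trans (cong sumℤ (ListP.map-++ h xs ys)) (sumℤ-++ (map h xs) (map h ys))

  ∑-filter : ∀ (p : A → Bool) (xs : List A) (h : A → ℤ) →
             ∑ (filter (λ a → p a Bool.≟ true) xs) h ≡ ∑ xs (λ a → ⟦ p a ⟧ * h a)
  ∑-filter p []       h = refl
  ∑-filter p (x ∷ xs) h with p x
  ... | true  = cong₂ _+_ (≡-sym (ℤP.*-identityˡ (h x))) (∑-filter p xs h)
  ... | false = trans (∑-filter p xs h) (≡-sym (ℤP.+-identityˡ _))

  ∑-none : ∀ (p : A → Bool) (xs : List A) → any p xs ≡ false → ∑ xs (λ a → ⟦ p a ⟧) ≡ + 0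
  ∑-none p []       _ = refl
  ∑-none p (x ∷ xs) none with p x
  ... | false = trans (ℤP.+-identityˡ _) (∑-none p xs none)

  count-∑ : ∀ (p : A → Bool) (xs : List A) → + count p xs ≡ ∑ xs (λ a → ⟦ p a ⟧)
  count-∑ p []       = refl
  count-∑ p (x ∷ xs) with p x
  ... | true  = trans (ℤP.pos-+ 1 (count p xs)) (cong (_+_ (+ 1)) (count-∑ p xs))
  ... | false = trans (count-∑ p xs) (≡-sym (ℤP.+-identityˡ _))

module _ {A B : Set} where

  ∑-swap : ∀ (xs : List A) (ys : List B) (h : A → B → ℤ) →
           ∑ xs (λ a → ∑ ys (h a)) ≡ ∑ ys (λ b → ∑ xs (λ a → h a b))
  ∑-swap []       ys h = ≡-sym (∑-zero ys)
  ∑-swap (x ∷ xs) ys h = trans (cong (_+_ (∑ ys (h x))) (∑-swap xs ys h)) (≡-sym (∑-+ ys (h x) _))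

  ∑-map : ∀ (f : A → B) (xs : List A) (h : B → ℤ) → ∑ (map f xs) h ≡ ∑ xs (h ∘ f)
  ∑-map f []       h = refl
  ∑-map f (x ∷ xs) h = cong (_+_ (h (f x))) (∑-map f xs h)

  ∑-concatMap : ∀ (f : A → List B) (xs : List A) (h : B → ℤ) →
                ∑ (concatMap f xs) h ≡ ∑ xs (λ x → ∑ (f x) h)
  ∑-concatMap f []       h = refl
  ∑-concatMap f (x ∷ xs) h = trans (∑-++ (f x) (concatMap f xs) h) (cong (_+_ (∑ (f x) h)) (∑-concatMap f xs h))

  -- The shape of the double sum in q̃.
  sumℤ-nested : ∀ (xs : List A) (ys : List B) (h : A → B → ℤ) →
                sumℤ (concatMap (λ a → map (h a) ys) xs) ≡ ∑ xs (λ a → ∑ ys (h a))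
  sumℤ-nested []       ys h = refl
  sumℤ-nested (x ∷ xs) ys h =
    trans (sumℤ-++ (map (h x) ys) _) (cong (_+_ (∑ ys (h x))) (sumℤ-nested xs ys h))

∑-allFin-suc : ∀ {n} (h : Fin (suc n) → ℤ) → ∑ (allFin (suc n)) h ≡ h zero + ∑ (allFin n) (h ∘ suc)
∑-allFin-suc {n} h = cong (λ l → h zero + sumℤ l)
  (trans (ListP.map-tabulate suc h) (≡-sym (ListP.map-tabulate id (h ∘ suc))))

count-by-partners : ∀ {A B : Set} (xs : List A) (ys : List B) (p : A → Bool) (R : A → B → Bool) →
  (∀ a → T (p a) → ∑ ys (λ b → ⟦ R a b ⟧) ≡ + 1) →
  ∑ xs (λ a → ⟦ p a ⟧) ≡ ∑ ys (λ b → ∑ xs (λ a → ⟦ p a ∧ R a b ⟧))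
count-by-partners xs ys p R unique = trans (∑-cong xs spread) (∑-swap xs ys _)
  where
  spread : ∀ a → ⟦ p a ⟧ ≡ ∑ ys (λ b → ⟦ p a ∧ R a b ⟧)
  spread a with p a in pa
  ... | true  = ≡-sym (unique a (subst T (≡-sym pa) _))
  ... | false = ≡-sym (∑-zero ys)

count-bijection : ∀ {A B : Set} (xs : List A) (ys : List B)
  (p : A → Bool) (q : B → Bool) (R : A → B → Bool) →
  (∀ a → T (p a) → ∑ ys (λ b → ⟦ R a b ⟧) ≡ + 1) →
  (∀ b → T (q b) → ∑ xs (λ a → ⟦ R a b ⟧) ≡ + 1) →
  (∀ a b → T (R a b) → T (p a) → T (q b)) →
  (∀ a b → T (R a b) → T (q b) → T (p a)) →
  ∑ xs (λ a → ⟦ p a ⟧) ≡ ∑ ys (λ b → ⟦ q b ⟧)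
count-bijection xs ys p q R uniqueᵖ uniqueᵠ p⇒q q⇒p = begin
  ∑ xs (λ a → ⟦ p a ⟧)                        ≡⟨ count-by-partners xs ys p R uniqueᵖ ⟩
  ∑ ys (λ b → ∑ xs (λ a → ⟦ p a ∧ R a b ⟧))  ≡⟨ ∑-cong ys (λ b → ∑-cong xs (λ a → cong ⟦_⟧ (same a b))) ⟩
  ∑ ys (λ b → ∑ xs (λ a → ⟦ q b ∧ R a b ⟧))  ≡⟨ ∑-swap ys xs _ ⟩
  ∑ xs (λ a → ∑ ys (λ b → ⟦ q b ∧ R a b ⟧))  ≡⟨ count-by-partners ys xs q (λ b a → R a b) uniqueᵠ ⟨
  ∑ ys (λ b → ⟦ q b ⟧)                        ∎
  where
  open ≡-Reasoning
  same : ∀ a b → p a ∧ R a b ≡ q b ∧ R a b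
  same a b = T-ext
    (λ t → let (pa , r) = ∧⁻ {p a} t in ∧⁺ (p⇒q a b r pa) r)
    (λ t → let (qb , r) = ∧⁻ {q b} t in ∧⁺ (q⇒p a b r qb) r)

_≗ᵇ_ : ∀ {m n} → (Fin m → Fin n) → (Fin m → Fin n) → Bool
_≗ᵇ_ {zero}  f g = true
_≗ᵇ_ {suc m} f g = (f zero == g zero) ∧ ((f ∘ suc) ≗ᵇ (g ∘ suc))

≗ᵇ⁻ : ∀ {m n} {f g : Fin m → Fin n} → T (f ≗ᵇ g) → ∀ i → f i ≡ g i
≗ᵇ⁻ {suc m} {f = f} {g} h zero    = ==⁻ (proj₁ (∧⁻ {f zero == g zero} h))
≗ᵇ⁻ {suc m} {f = f} {g} h (suc i) = ≗ᵇ⁻ {f = f ∘ suc} {g ∘ suc} (proj₂ (∧⁻ {f zero == g zero} h)) i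

≗ᵇ⁺ : ∀ {m n} {f g : Fin m → Fin n} → (∀ i → f i ≡ g i) → T (f ≗ᵇ g)
≗ᵇ⁺ {zero}  e = _
≗ᵇ⁺ {suc m} {f = f} {g} e = ∧⁺ (==⁺ (e zero)) (≗ᵇ⁺ {f = f ∘ suc} {g ∘ suc} (e ∘ suc))

_≡ᵛ_ : ∀ {n} → Subset n → Subset n → Bool
[]      ≡ᵛ []      = true
(a ∷ U) ≡ᵛ (b ∷ V) = (a ⇔ᵇ b) ∧ (U ≡ᵛ V)

≡ᵛ⁺ : ∀ {n} {U V : Subset n} → (∀ k → lookup U k ≡ lookup V k) → T (U ≡ᵛ V)
≡ᵛ⁺ {U = []}    {[]}    e = _
≡ᵛ⁺ {U = a ∷ U} {b ∷ V} e = ∧⁺ (⇔ᵇ⁺ (e zero)) (≡ᵛ⁺ {U = U} {V} (e ∘ suc))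

≡ᵛ⁻ : ∀ {n} {U V : Subset n} → T (U ≡ᵛ V) → ∀ k → lookup U k ≡ lookup V k
≡ᵛ⁻ {U = a ∷ U} {b ∷ V} h zero    = ⇔ᵇ⁻ (proj₁ (∧⁻ {a ⇔ᵇ b} h))
≡ᵛ⁻ {U = a ∷ U} {b ∷ V} h (suc k) = ≡ᵛ⁻ {U = U} {V} (proj₂ (∧⁻ {a ⇔ᵇ b} h)) k

==-refl : ∀ {n} (i : Fin n) → (i == i) ≡ true
==-refl i = T-ext (λ _ → _) (λ _ → ==⁺ refl)

==-suc : ∀ {n} (i j : Fin n) → (suc i == suc j) ≡ (i == j)
==-suc i j = T-ext (λ t → ==⁺ (Fin.suc-injective (==⁻ t))) (λ t → ==⁺ (cong suc (==⁻ t)))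

==-zero-suc : ∀ {n} (j : Fin n) → (zero == suc j) ≡ false
==-zero-suc j = T-ext (λ t → ⊥-elim (Fin.0≢1+n (==⁻ {i = zero} {suc j} t))) (λ ())

==-suc-zero : ∀ {n} (j : Fin n) → (suc j == zero) ≡ false
==-suc-zero j = T-ext (λ t → ⊥-elim (Fin.0≢1+n (≡-sym (==⁻ {i = suc j} {zero} t)))) (λ ())

allFin-unique : ∀ {n} (c : Fin n) → ∑ (allFin n) (λ k → ⟦ k == c ⟧) ≡ + 1
allFin-unique {suc n} zero = begin
  ∑ (allFin (suc n)) (λ k → ⟦ k == zero ⟧)          ≡⟨ ∑-allFin-suc {n} (λ k → ⟦ k == zero ⟧) ⟩
  ⟦ _==_ {suc n} zero zero ⟧ + ∑ (allFin n) (λ k → ⟦ suc k == zero ⟧)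
    ≡⟨ cong₂ _+_ (cong ⟦_⟧ (==-refl {suc n} zero)) (∑-cong (allFin n) (λ k → cong ⟦_⟧ (==-suc-zero k))) ⟩
  + 1 + ∑ (allFin n) (λ _ → + 0)                     ≡⟨ cong (_+_ (+ 1)) (∑-zero (allFin n)) ⟩
  + 1                                                ∎
  where open ≡-Reasoning
allFin-unique {suc n} (suc c) = begin
  ∑ (allFin (suc n)) (λ k → ⟦ k == suc c ⟧)         ≡⟨ ∑-allFin-suc {n} (λ k → ⟦ k == suc c ⟧) ⟩
  ⟦ zero == suc c ⟧ + ∑ (allFin n) (λ k → ⟦ suc k == suc c ⟧)
    ≡⟨ cong₂ _+_ (cong ⟦_⟧ (==-zero-suc c)) (∑-cong (allFin n) (λ k → cong ⟦_⟧ (==-suc k c))) ⟩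
  + 0 + ∑ (allFin n) (λ k → ⟦ k == c ⟧)             ≡⟨ ℤP.+-identityˡ _ ⟩
  ∑ (allFin n) (λ k → ⟦ k == c ⟧)                   ≡⟨ allFin-unique c ⟩
  + 1                                                ∎
  where open ≡-Reasoning

allMaps-unique : ∀ m n (c : Fin m → Fin n) → ∑ (allMaps m n) (λ f → ⟦ f ≗ᵇ c ⟧) ≡ + 1
allMaps-unique zero    n c = refl
allMaps-unique (suc m) n c = begin
  ∑ (allMaps (suc m) n) (λ f → ⟦ f ≗ᵇ c ⟧)
    ≡⟨ ∑-concatMap _ (allMaps m n) _ ⟩
  ∑ (allMaps m n) (λ f → ∑ (map (λ k → cons k f) (allFin n)) (λ g → ⟦ g ≗ᵇ c ⟧))
    ≡⟨ ∑-cong (allMaps m n) (λ f → ∑-map _ (allFin n) _) ⟩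
  ∑ (allMaps m n) (λ f → ∑ (allFin n) (λ k → ⟦ (k == c zero) ∧ (f ≗ᵇ (c ∘ suc)) ⟧))
    ≡⟨ ∑-cong (allMaps m n) (λ f → trans (∑-cong (allFin n) (λ k → ⟦∧⟧ (k == c zero) (f ≗ᵇ (c ∘ suc))))
                                         (≡-sym (∑-*ʳ (allFin n) _ _))) ⟩
  ∑ (allMaps m n) (λ f → ∑ (allFin n) (λ k → ⟦ k == c zero ⟧) * ⟦ f ≗ᵇ (c ∘ suc) ⟧)
    ≡⟨ ∑-cong (allMaps m n) (λ f → trans (cong (_* ⟦ f ≗ᵇ (c ∘ suc) ⟧) (allFin-unique (c zero)))
                                         (ℤP.*-identityˡ _)) ⟩
  ∑ (allMaps m n) (λ f → ⟦ f ≗ᵇ (c ∘ suc) ⟧)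
    ≡⟨ allMaps-unique m n (c ∘ suc) ⟩
  + 1 ∎
  where open ≡-Reasoning

allSubsets-unique : ∀ n (c : Subset n) → ∑ (allSubsets n) (λ U → ⟦ U ≡ᵛ c ⟧) ≡ + 1
allSubsets-unique zero    []      = refl
allSubsets-unique (suc n) (b ∷ c) =
  trans (∑-concatMap _ (allSubsets n) _)
        (trans (∑-cong (allSubsets n) (oneChoice b)) (allSubsets-unique n c))
  where
  -- of the two extensions of U, only the one agreeing with b can equal b ∷ c
  oneChoice : ∀ b U →
    ⟦ (false ⇔ᵇ b) ∧ (U ≡ᵛ c) ⟧ + (⟦ (true ⇔ᵇ b) ∧ (U ≡ᵛ c) ⟧ + + 0) ≡ ⟦ U ≡ᵛ c ⟧
  oneChoice true  U = trans (ℤP.+-identityˡ _) (ℤP.+-identityʳ _)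
  oneChoice false U = ℤP.+-identityʳ _

image-unique : ∀ {m n} (f : Fin m → Fin n) → ∑ (allSubsets n) (λ U → ⟦ imageIs f U ⟧) ≡ + 1
image-unique {n = n} f = trans (∑-cong (allSubsets n) λ U → cong ⟦_⟧ (T-ext
    (λ t → ≡ᵛ⁺ {U = U} {image f} (imageIs⁻ f {U} t))
    (λ t → imageIs⁺ f {U} (≡ᵛ⁻ {U = U} {image f} t))))
  (allSubsets-unique n (image f))

-- Orbit counting: if J is isomorphic to G[U], the isomorphisms from J onto
-- G[U] are in bijection with the automorphisms of J (σ ↦ f₀ ∘ σ).
orbit-count : ∀ {m n} {J : Graph m} {G : Graph n} {U : Subset n} {f₀ : Fin m → Fin n} →
  IsIsoOnto J G U f₀ → ∑ (allMaps m n) (λ φ → ⟦ isoOnto J G U φ ⟧) ≡ + autCount J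
orbit-count {m} {n} {J} {G} {U} {f₀} iso₀ = ≡-sym (trans (count-∑ _ (allMaps m m))
  (count-bijection (allMaps m m) (allMaps m n) (isAutomorphism J) (isoOnto J G U)
    (λ σ φ → φ ≗ᵇ (f₀ ∘ σ)) (λ σ _ → allMaps-unique m n (f₀ ∘ σ)) uniqueFactor
    (λ σ φ r aut → isoOnto⁺ (iso-from-aut (isAutomorphism⁻ aut) (≗ᵇ⁻ r)))
    (λ σ φ r iso → isAutomorphism⁺ (aut-from-iso (isoOnto⁻ iso) (≗ᵇ⁻ r)))))
  where
  open IsomorphismsOnto iso₀
  uniqueFactor : ∀ φ → T (isoOnto J G U φ) → ∑ (allMaps m m) (λ σ → ⟦ φ ≗ᵇ (f₀ ∘ σ) ⟧) ≡ + 1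
  uniqueFactor φ t = trans (∑-cong (allMaps m m) (λ σ → cong ⟦_⟧ (T-ext
      (λ r → ≗ᵇ⁺ (factor⁻ (isoOnto⁻ t) σ (≗ᵇ⁻ r)))
      (λ r → ≗ᵇ⁺ (factor⁺ (isoOnto⁻ t) σ (≗ᵇ⁻ r))))))
    (allMaps-unique m m (λ i → preimage i (φ i)))

isoOnto-count : ∀ {m n} (J : Graph m) (G : Graph n) (U : Subset n) →
  ∑ (allMaps m n) (λ φ → ⟦ isoOnto J G U φ ⟧) ≡ + autCount J * ⟦ inducedIso J G U ⟧
isoOnto-count {m} {n} J G U with inducedIso J G U in isomorphic
... | false = trans (∑-none (isoOnto J G U) (allMaps m n) isomorphic) (≡-sym (ℤP.*-zeroʳ (+ autCount J)))
... | true with any-witness (isoOnto J G U) (allMaps m n) (subst T (≡-sym isomorphic) _)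
...   | f₀ , f₀-iso = trans (orbit-count (isoOnto⁻ {J = J} {G} {U} {f₀} f₀-iso))
                            (≡-sym (ℤP.*-identityʳ (+ autCount J)))

embedding-with-image : ∀ {m n} (J : Graph m) (G : Graph n) (M U : Subset n) (f : Fin m → Fin n) →
  (embedsInto J G M f ∧ imageIs f U) ≡ ((U ⊆ᵇ M) ∧ isoOnto J G U f)
embedding-with-image J G M U f = T-ext
  (λ t → let (emb , img) = ∧⁻ {embedsInto J G M f} t
             open IsEmbeddingInto (embedsInto⁻ {J = J} {G} {M} {f} emb)
             (inside′ , onto) = imageIs-spec⁻ f {U} img
         in ∧⁺ (⊆ᵇ⁺ {U = U} {M} λ k k∈U →
                  let (i , fi≡k) = onto k k∈U in subst (λ z → T (z ∈ˢ M)) fi≡k (inside i))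
               (isoOnto⁺ {J = J} {G} {U} {f} record
                  { injective = injective ; inside = inside′ ; onto = onto ; preserves = preserves }))
  (λ t → let (U⊆M , iso) = ∧⁻ {U ⊆ᵇ M} t
             open IsIsoOnto (isoOnto⁻ {J = J} {G} {U} {f} iso)
         in ∧⁺ (embedsInto⁺ {J = J} {G} {M} {f} record { injective = injective ; preserves = preserves
                                   ; inside = λ i → ⊆ᵇ⁻ {U = U} {M} U⊆M (f i) (inside i) })
               (imageIs-spec⁺ f {U} inside onto))

-- Counting embeddings by their images: every induced copy of J inside G[M]
-- is the image of exactly Aut(J) embeddings.
embeddings-count : ∀ {m n} (J : Graph m) (G : Graph n) (M : Subset n) →
  ∑ (allMaps m n) (λ f → ⟦ embedsInto J G M f ⟧) ≡ + autCount J * + sInd J G M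
embeddings-count {m} {n} J G M = begin
  ∑ (allMaps m n) (λ f → ⟦ embedsInto J G M f ⟧)
    ≡⟨ count-by-partners (allMaps m n) (allSubsets n) (embedsInto J G M) (λ f U → imageIs f U)
                         (λ f _ → image-unique f) ⟩
  ∑ (allSubsets n) (λ U → ∑ (allMaps m n) (λ f → ⟦ embedsInto J G M f ∧ imageIs f U ⟧))
    ≡⟨ ∑-cong (allSubsets n) (λ U → ∑-cong (allMaps m n) (λ f →
         trans (cong ⟦_⟧ (embedding-with-image J G M U f)) (⟦∧⟧ (U ⊆ᵇ M) (isoOnto J G U f)))) ⟩
  ∑ (allSubsets n) (λ U → ∑ (allMaps m n) (λ f → ⟦ U ⊆ᵇ M ⟧ * ⟦ isoOnto J G U f ⟧))
    ≡⟨ ∑-cong (allSubsets n) (λ U → ≡-sym (∑-*ˡ ⟦ U ⊆ᵇ M ⟧ (allMaps m n) _)) ⟩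
  ∑ (allSubsets n) (λ U → ⟦ U ⊆ᵇ M ⟧ * ∑ (allMaps m n) (λ f → ⟦ isoOnto J G U f ⟧))
    ≡⟨ ∑-cong (allSubsets n) (λ U → cong (⟦ U ⊆ᵇ M ⟧ *_) (isoOnto-count J G U)) ⟩
  ∑ (allSubsets n) (λ U → ⟦ U ⊆ᵇ M ⟧ * (+ autCount J * ⟦ inducedIso J G U ⟧))
    ≡⟨ ∑-cong (allSubsets n) (λ U → regroup ⟦ U ⊆ᵇ M ⟧ (⟦ inducedIso J G U ⟧)) ⟩
  ∑ (allSubsets n) (λ U → + autCount J * (⟦ U ⊆ᵇ M ⟧ * ⟦ inducedIso J G U ⟧))
    ≡⟨ ∑-cong (allSubsets n) (λ U → cong (+ autCount J *_) (≡-sym (⟦∧⟧ (U ⊆ᵇ M) (inducedIso J G U)))) ⟩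
  ∑ (allSubsets n) (λ U → + autCount J * ⟦ (U ⊆ᵇ M) ∧ inducedIso J G U ⟧)
    ≡⟨ ∑-*ˡ (+ autCount J) (allSubsets n) _ ⟨
  + autCount J * ∑ (allSubsets n) (λ U → ⟦ (U ⊆ᵇ M) ∧ inducedIso J G U ⟧)
    ≡⟨ cong (+ autCount J *_) (count-∑ _ (allSubsets n)) ⟨
  + autCount J * + sInd J G M ∎
  where
  open ≡-Reasoning
  regroup : ∀ a b → a * (+ autCount J * b) ≡ + autCount J * (a * b)
  regroup a b = solve 3 (λ a c b → a :* (c :* b) := c :* (a :* b)) refl a (+ autCount J) b

count-mono : ∀ {A : Set} {p q : A → Bool} (xs : List A) →
  (∀ a → T (q a) → T (p a)) → count q xs ℕ.≤ count p xs
count-mono []       _ = ℕ.z≤n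
count-mono {p = p} {q} (x ∷ xs) q⇒p with q x in qx | p x in px
... | true  | true  = ℕ.s≤s (count-mono xs q⇒p)
... | true  | false = ⊥-elim (subst T px (q⇒p x (subst T (≡-sym qx) _)))
... | false | true  = ℕP.m≤n⇒m≤1+n (count-mono xs q⇒p)
... | false | false = count-mono xs q⇒p

-- The identity is an automorphism, so Aut(J) ≥ 1.
autCount-positive : ∀ {m} (J : Graph m) → 1 ℕ.≤ autCount J
autCount-positive {m} J = ℕP.≤-trans (ℕP.≤-reflexive (≡-sym identityOnce))
  (count-mono (allMaps m m) λ σ σ≗id → isAutomorphism⁺ (identity-like σ (≗ᵇ⁻ σ≗id)))
  where
  identityOnce : count (λ σ → σ ≗ᵇ id) (allMaps m m) ≡ 1
  identityOnce = ℤP.+-injective (trans (count-∑ _ (allMaps m m)) (allMaps-unique m m id))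
  identity-like : ∀ σ → (∀ i → σ i ≡ i) → IsAutomorphism J σ
  identity-like σ σ≗id = record
    { injective  = λ {i} {j} σi≡σj → trans (≡-sym (σ≗id i)) (trans σi≡σj (σ≗id j))
    ; surjective = λ k → k , σ≗id k
    ; preserves  = λ i j → ≡-sym (cong₂ (adj J) (σ≗id i) (σ≗id j))
    }

negOnePow-+ : ∀ a b → negOnePow (a ℕ.+ b) ≡ negOnePow a * negOnePow b
negOnePow-+ zero    b = ≡-sym (ℤP.*-identityˡ _)
negOnePow-+ (suc a) b = trans (cong -_ (negOnePow-+ a b)) (ℤP.neg-distribˡ-* (negOnePow a) (negOnePow b))

signed : Bool → ℤ → ℤ
signed b z = if b then - z else z

sign-product : ∀ {A : Set} (p : A → Bool) (h : A → ℤ) (L : List A) →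
  negOnePow (count p L) * prodℤ (map h L) ≡ prodℤ (map (λ a → signed (p a) (h a)) L)
sign-product p h []      = refl
sign-product p h (a ∷ L) with p a
... | true  = trans (solve 3 (λ s x r → (:- s) :* (x :* r) := (:- x) :* (s :* r)) refl
                      (negOnePow (count p L)) (h a) (prodℤ (map h L)))
                    (cong (_*_ (- h a)) (sign-product p h L))
... | false = trans (solve 3 (λ s x r → s :* (x :* r) := x :* (s :* r)) refl
                      (negOnePow (count p L)) (h a) (prodℤ (map h L)))
                    (cong (_*_ (h a)) (sign-product p h L))

sublists-expansion : ∀ {A : Set} (f : A → ℤ) (L : List A) →
  ∑ (sublists L) (λ E → prodℤ (map f E)) ≡ prodℤ (map (λ e → + 1 + f e) L)
sublists-expansion f []      = refl
sublists-expansion {A} f (a ∷ L) = begin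
  ∑ (r ++ map (a ∷_) r) P                ≡⟨ ∑-++ r (map (a ∷_) r) P ⟩
  ∑ r P + ∑ (map (a ∷_) r) P             ≡⟨ cong (_+_ (∑ r P)) (∑-map (a ∷_) r P) ⟩
  ∑ r P + ∑ r (λ E → f a * P E)          ≡⟨ cong (_+_ (∑ r P)) (∑-*ˡ (f a) r P) ⟨
  ∑ r P + f a * ∑ r P                    ≡⟨ solve 2 (λ s x → s :+ x :* s := (con (+ 1) :+ x) :* s) refl (∑ r P) (f a) ⟩
  (+ 1 + f a) * ∑ r P                    ≡⟨ cong (_*_ (+ 1 + f a)) (sublists-expansion f L) ⟩
  prodℤ (map (λ e → + 1 + f e) (a ∷ L))  ∎
  where
  open ≡-Reasoning
  r : List (List A)
  r = sublists L
  P : List A → ℤ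
  P E = prodℤ (map f E)

subsets-expansion : ∀ m (g : Fin m → ℤ) →
  ∑ (allSubsets m) (λ V → prodℤ (tabulate (λ u → if lookup V u then g u else + 1)))
  ≡ prodℤ (tabulate (λ u → + 1 + g u))
subsets-expansion zero    g = refl
subsets-expansion (suc m) g = begin
  ∑ (allSubsets (suc m)) Q                                ≡⟨ ∑-concatMap _ (allSubsets m) Q ⟩
  ∑ (allSubsets m) (λ U → Q (false ∷ U) + (Q (true ∷ U) + + 0))
    ≡⟨ ∑-cong (allSubsets m) (λ U → solve 2 (λ q x → con (+ 1) :* q :+ (x :* q :+ con (+ 0)) := (con (+ 1) :+ x) :* q)
                                             refl (Q′ U) (g zero)) ⟩
  ∑ (allSubsets m) (λ U → (+ 1 + g zero) * Q′ U)          ≡⟨ ∑-*ˡ (+ 1 + g zero) (allSubsets m) Q′ ⟨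
  (+ 1 + g zero) * ∑ (allSubsets m) Q′                    ≡⟨ cong (_*_ (+ 1 + g zero)) (subsets-expansion m (g ∘ suc)) ⟩
  prodℤ (tabulate (λ u → + 1 + g u))                      ∎
  where
  open ≡-Reasoning
  Q : Subset (suc m) → ℤ
  Q V = prodℤ (tabulate (λ u → if lookup V u then g u else + 1))
  Q′ : Subset m → ℤ
  Q′ U = prodℤ (tabulate (λ u → if lookup U u then g (suc u) else + 1))

twos-product : ∀ {A : Set} (b : A → Bool) (L : List A) →
  prodℤ (map (λ a → if b a then + 2 else + 0) L) ≡ + (2 ℕ.^ length L) * ⟦ all b L ⟧
twos-product b []      = refl
twos-product b (a ∷ L) with b a
... | true  = begin
  + 2 * prodℤ (map (λ a → if b a then + 2 else + 0) L)  ≡⟨ cong (_*_ (+ 2)) (twos-product b L) ⟩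
  + 2 * (+ (2 ℕ.^ length L) * ⟦ all b L ⟧)              ≡⟨ ℤP.*-assoc (+ 2) (+ (2 ℕ.^ length L)) ⟦ all b L ⟧ ⟨
  (+ 2 * + (2 ℕ.^ length L)) * ⟦ all b L ⟧              ≡⟨ cong (_* ⟦ all b L ⟧) (ℤP.pos-* 2 (2 ℕ.^ length L)) ⟨
  + (2 ℕ.^ suc (length L)) * ⟦ all b L ⟧                ∎
  where open ≡-Reasoning
... | false = trans (ℤP.*-zeroˡ (prodℤ (map (λ a → if b a then + 2 else + 0) L)))
                    (≡-sym (ℤP.*-zeroʳ (+ (2 ℕ.^ suc (length L)))))

∑∑-factor : ∀ {A B C : Set} (xs : List A) (ys : List B) (zs : List C)
  (s : A → ℤ) (t : B → ℤ) (f : A → C → ℤ) (g : B → C → ℤ) →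
  ∑ xs (λ a → ∑ ys (λ b → (s a * t b) * ∑ zs (λ c → g b c * f a c)))
  ≡ ∑ zs (λ c → ∑ ys (λ b → t b * g b c) * ∑ xs (λ a → s a * f a c))
∑∑-factor xs ys zs s t f g = begin
  ∑ xs (λ a → ∑ ys (λ b → (s a * t b) * ∑ zs (λ c → g b c * f a c)))
    ≡⟨ ∑-cong xs (λ a → ∑-cong ys (λ b → ∑-*ˡ (s a * t b) zs _)) ⟩
  ∑ xs (λ a → ∑ ys (λ b → ∑ zs (λ c → (s a * t b) * (g b c * f a c))))
    ≡⟨ ∑-cong xs (λ a → ∑-swap ys zs _) ⟩
  ∑ xs (λ a → ∑ zs (λ c → ∑ ys (λ b → (s a * t b) * (g b c * f a c))))
    ≡⟨ ∑-swap xs zs _ ⟩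
  ∑ zs (λ c → ∑ xs (λ a → ∑ ys (λ b → (s a * t b) * (g b c * f a c))))
    ≡⟨ ∑-cong zs (λ c → ∑-cong xs (λ a → ∑-cong ys (λ b → regroup (s a) (t b) (g b c) (f a c)))) ⟩
  ∑ zs (λ c → ∑ xs (λ a → ∑ ys (λ b → (t b * g b c) * (s a * f a c))))
    ≡⟨ ∑-cong zs (λ c → ∑-cong xs (λ a → ∑-*ʳ ys _ (s a * f a c))) ⟨
  ∑ zs (λ c → ∑ xs (λ a → ∑ ys (λ b → t b * g b c) * (s a * f a c)))
    ≡⟨ ∑-cong zs (λ c → ∑-*ˡ (∑ ys (λ b → t b * g b c)) xs _) ⟨
  ∑ zs (λ c → ∑ ys (λ b → t b * g b c) * ∑ xs (λ a → s a * f a c)) ∎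
  where
  open ≡-Reasoning
  regroup : ∀ s t g f → (s * t) * (g * f) ≡ (t * g) * (s * f)
  regroup = solve 4 (λ s t g f → (s :* t) :* (g :* f) := (t :* g) :* (s :* f)) refl

xValue : Bool → ℤ
xValue b = if b then + 1 else -[1+ 0 ]

edge-factor : ∀ a b → + 1 + signed (not a) (xValue b) ≡ (if a ⇔ᵇ b then + 2 else + 0)
edge-factor true  true  = refl
edge-factor true  false = refl
edge-factor false true  = refl
edge-factor false false = refl

vertex-factor : ∀ b → + 1 + - xValue b ≡ (if not b then + 2 else + 0)
vertex-factor true  = refl
vertex-factor false = refl

signed-choice : ∀ b z → signed b (if b then z else + 1) ≡ (if b then - z else + 1)
signed-choice true  z = refl
signed-choice false z = refl

module SignedSum {m n : ℕ} (J : Graph m) (G : Graph n) (w : Fin n) where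

  S : Subset n
  S = allBut w

  M : Subset n
  M = minusNbhd G w

  k : ℕ
  k = length (edgesK m)

  nonEdge : Fin m × Fin m → Bool
  nonEdge e = not (adj J (proj₁ e) (proj₂ e))

  signedSum : ℤ
  signedSum = sumℤ (concatMap (λ V → map (λ E →
      negOnePow (sizeˢ V ℕ.+ count nonEdge E) * kTilde E V S (xG G) (λ u → xG G u w))
    (sublists (edgesK m))) (allSubsets m))

  edgeTerm : (Fin m → Fin n) → List (Fin m × Fin m) → ℤ
  edgeTerm φ E = prodℤ (map (λ e → xG G (φ (proj₁ e)) (φ (proj₂ e))) E)

  vertexTerm : (Fin m → Fin n) → Subset m → ℤ
  vertexTerm φ V = prodℤ (map (λ u → if u ∈ˢ V then xG G (φ u) w else + 1) (allFin m))

  agrees : (Fin m → Fin n) → Fin m × Fin m → Bool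
  agrees φ e = adj J (proj₁ e) (proj₂ e) ⇔ᵇ adj G (φ (proj₁ e)) (φ (proj₂ e))

  avoids : (Fin m → Fin n) → Fin m → Bool
  avoids φ u = not (adj G (φ u) w)

  edgeWeight : (Fin m → Fin n) → ℤ
  edgeWeight φ = ∑ (sublists (edgesK m)) (λ E → negOnePow (count nonEdge E) * edgeTerm φ E)

  vertexWeight : (Fin m → Fin n) → ℤ
  vertexWeight φ = ∑ (allSubsets m) (λ V → negOnePow (sizeˢ V) * vertexTerm φ V)

  edgeWeight-value : ∀ φ → edgeWeight φ ≡ + (2 ℕ.^ k) * ⟦ all (agrees φ) (edgesK m) ⟧
  edgeWeight-value φ = begin
    edgeWeight φ
      ≡⟨ ∑-cong (sublists (edgesK m)) (λ E → sign-product nonEdge xφ E) ⟩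
    ∑ (sublists (edgesK m)) (λ E → prodℤ (map (λ e → signed (nonEdge e) (xφ e)) E))
      ≡⟨ sublists-expansion (λ e → signed (nonEdge e) (xφ e)) (edgesK m) ⟩
    prodℤ (map (λ e → + 1 + signed (nonEdge e) (xφ e)) (edgesK m))
      ≡⟨ cong prodℤ (ListP.map-cong (λ e → edge-factor (adj J (proj₁ e) (proj₂ e)) _) (edgesK m)) ⟩
    prodℤ (map (λ e → if agrees φ e then + 2 else + 0) (edgesK m))
      ≡⟨ twos-product (agrees φ) (edgesK m) ⟩
    + (2 ℕ.^ k) * ⟦ all (agrees φ) (edgesK m) ⟧ ∎
    where
    open ≡-Reasoning
    xφ : Fin m × Fin m → ℤ
    xφ e = xG G (φ (proj₁ e)) (φ (proj₂ e))

  vertexWeight-value : ∀ φ → vertexWeight φ ≡ + (2 ℕ.^ m) * ⟦ all (avoids φ) (allFin m) ⟧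
  vertexWeight-value φ = begin
    vertexWeight φ
      ≡⟨ ∑-cong (allSubsets m) (λ V → trans (sign-product (lookup V) _ (allFin m))
           (trans (cong prodℤ (ListP.map-tabulate id (λ u → signed (lookup V u) (if lookup V u then yφ u else + 1))))
                  (cong prodℤ (ListP.tabulate-cong (λ u → signed-choice (lookup V u) (yφ u)))))) ⟩
    ∑ (allSubsets m) (λ V → prodℤ (tabulate (λ u → if lookup V u then - yφ u else + 1)))
      ≡⟨ subsets-expansion m (λ u → - yφ u) ⟩
    prodℤ (tabulate (λ u → + 1 + - yφ u))
      ≡⟨ cong prodℤ (ListP.tabulate-cong (λ u → vertex-factor (adj G (φ u) w))) ⟩
    prodℤ (tabulate (λ u → if avoids φ u then + 2 else + 0))
      ≡⟨ cong prodℤ (ListP.map-tabulate id (λ u → if avoids φ u then + 2 else + 0)) ⟨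
    prodℤ (map (λ u → if avoids φ u then + 2 else + 0) (allFin m))
      ≡⟨ twos-product (avoids φ) (allFin m) ⟩
    + (2 ℕ.^ length (allFin m)) * ⟦ all (avoids φ) (allFin m) ⟧
      ≡⟨ cong (λ l → + (2 ℕ.^ l) * ⟦ all (avoids φ) (allFin m) ⟧) (ListP.length-tabulate {n = m} id) ⟩
    + (2 ℕ.^ m) * ⟦ all (avoids φ) (allFin m) ⟧ ∎
    where
    open ≡-Reasoning
    yφ : Fin m → ℤ
    yφ u = xG G (φ u) w

  signedSum-factorized : signedSum ≡ ∑ (injInto S) (λ φ → edgeWeight φ * vertexWeight φ)
  signedSum-factorized = begin
    signedSum
      ≡⟨ sumℤ-nested (allSubsets m) (sublists (edgesK m)) _ ⟩
    ∑ (allSubsets m) (λ V → ∑ (sublists (edgesK m)) (λ E →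
       negOnePow (sizeˢ V ℕ.+ count nonEdge E) * ∑ (injInto S) (λ φ → edgeTerm φ E * vertexTerm φ V)))
      ≡⟨ ∑-cong (allSubsets m) (λ V → ∑-cong (sublists (edgesK m)) (λ E →
           cong (_* ∑ (injInto S) (λ φ → edgeTerm φ E * vertexTerm φ V)) (negOnePow-+ (sizeˢ V) (count nonEdge E)))) ⟩
    ∑ (allSubsets m) (λ V → ∑ (sublists (edgesK m)) (λ E →
       (negOnePow (sizeˢ V) * negOnePow (count nonEdge E)) * ∑ (injInto S) (λ φ → edgeTerm φ E * vertexTerm φ V)))
      ≡⟨ ∑∑-factor (allSubsets m) (sublists (edgesK m)) (injInto S) (negOnePow ∘ sizeˢ) (negOnePow ∘ count nonEdge)
                    (λ V φ → vertexTerm φ V) (λ E φ → edgeTerm φ E) ⟩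
    ∑ (injInto S) (λ φ → edgeWeight φ * vertexWeight φ) ∎
    where open ≡-Reasoning

  ∈-M : ∀ v → (v ∈ˢ M) ≡ (v ∈ˢ S) ∧ not (adj G v w)
  ∈-M v = trans (Vec.lookup∘tabulate _ v)
    (cong₂ _∧_ (≡-sym (Vec.lookup∘tabulate _ v)) (cong not (Graph.sym G w v)))

  injectiveIntoS : (Fin m → Fin n) → Bool
  injectiveIntoS φ = isInjective φ ∧ all (λ u → φ u ∈ˢ S) (allFin m)

  agreesAndAvoids : (Fin m → Fin n) → Bool
  agreesAndAvoids φ = all (agrees φ) (edgesK m) ∧ all (avoids φ) (allFin m)

  -- The injections into S with nonzero weight are the embeddings of J into G[M].
  surviving-embeddings : ∀ φ → (injectiveIntoS φ ∧ agreesAndAvoids φ) ≡ embedsInto J G M φ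
  surviving-embeddings φ = T-ext into from
    where
    into : T (injectiveIntoS φ ∧ agreesAndAvoids φ) → T (embedsInto J G M φ)
    into t = embedsInto⁺ {J = J} {G} {M} {φ} record
      { injective = isInjective⁻ {f = φ} (proj₁ (∧⁻ {isInjective φ} injInS))
      ; preserves = preserves-from-pairs J G φ λ i j i<j →
          ⇔ᵇ⁻ (all-edgesK⁻ (agrees φ) (proj₁ (∧⁻ {all (agrees φ) (edgesK m)} agrAvd)) i j i<j)
      ; inside    = λ u → subst T (≡-sym (∈-M (φ u))) (∧⁺
          (all-allFin⁻ (λ u → φ u ∈ˢ S) (proj₂ (∧⁻ {isInjective φ} injInS)) u)
          (all-allFin⁻ (avoids φ) (proj₂ (∧⁻ {all (agrees φ) (edgesK m)} agrAvd)) u))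
      }
      where
      injInS : T (injectiveIntoS φ)
      injInS = proj₁ (∧⁻ {injectiveIntoS φ} t)
      agrAvd : T (agreesAndAvoids φ)
      agrAvd = proj₂ (∧⁻ {injectiveIntoS φ} t)
    from : T (embedsInto J G M φ) → T (injectiveIntoS φ ∧ agreesAndAvoids φ)
    from t = ∧⁺
      (∧⁺ (isInjective⁺ injective)
          (all-allFin⁺ (λ u → φ u ∈ˢ S) (λ u → proj₁ (∧⁻ {φ u ∈ˢ S} (inM u)))))
      (∧⁺ (all-edgesK⁺ (agrees φ) (λ i j _ → ⇔ᵇ⁺ (preserves i j)))
          (all-allFin⁺ (avoids φ) (λ u → proj₂ (∧⁻ {φ u ∈ˢ S} (inM u)))))
      where
      open IsEmbeddingInto (embedsInto⁻ {J = J} {G} {M} {φ} t)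
      inM : ∀ u → T ((φ u ∈ˢ S) ∧ avoids φ u)
      inM u = subst T (∈-M (φ u)) (inside u)

  weights-value : ∀ φ → edgeWeight φ * vertexWeight φ ≡ + (2 ℕ.^ (k ℕ.+ m)) * ⟦ agreesAndAvoids φ ⟧
  weights-value φ = begin
    edgeWeight φ * vertexWeight φ
      ≡⟨ cong₂ _*_ (edgeWeight-value φ) (vertexWeight-value φ) ⟩
    (+ (2 ℕ.^ k) * ⟦ a ⟧) * (+ (2 ℕ.^ m) * ⟦ b ⟧)
      ≡⟨ solve 4 (λ p a q b → (p :* a) :* (q :* b) := (p :* q) :* (a :* b)) refl
                 (+ (2 ℕ.^ k)) ⟦ a ⟧ (+ (2 ℕ.^ m)) ⟦ b ⟧ ⟩
    (+ (2 ℕ.^ k) * + (2 ℕ.^ m)) * (⟦ a ⟧ * ⟦ b ⟧)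
      ≡⟨ cong₂ _*_ (trans (≡-sym (ℤP.pos-* (2 ℕ.^ k) (2 ℕ.^ m))) (cong +_ (≡-sym (ℕP.^-distribˡ-+-* 2 k m))))
                   (≡-sym (⟦∧⟧ a b)) ⟩
    + (2 ℕ.^ (k ℕ.+ m)) * ⟦ agreesAndAvoids φ ⟧ ∎
    where
    open ≡-Reasoning
    a b : Bool
    a = all (agrees φ) (edgesK m)
    b = all (avoids φ) (allFin m)

  signedSum-value : signedSum ≡ + (2 ℕ.^ (k ℕ.+ m) ℕ.* autCount J ℕ.* sInd J G M)
  signedSum-value = begin
    signedSum
      ≡⟨ signedSum-factorized ⟩
    ∑ (injInto S) (λ φ → edgeWeight φ * vertexWeight φ)
      ≡⟨ ∑-cong (injInto S) weights-value ⟩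
    ∑ (injInto S) (λ φ → + c * ⟦ agreesAndAvoids φ ⟧)
      ≡⟨ ∑-filter injectiveIntoS (allMaps m n) _ ⟩
    ∑ (allMaps m n) (λ φ → ⟦ injectiveIntoS φ ⟧ * (+ c * ⟦ agreesAndAvoids φ ⟧))
      ≡⟨ ∑-cong (allMaps m n) (λ φ → trans (regroup ⟦ injectiveIntoS φ ⟧ ⟦ agreesAndAvoids φ ⟧)
           (cong (+ c *_) (trans (≡-sym (⟦∧⟧ (injectiveIntoS φ) _)) (cong ⟦_⟧ (surviving-embeddings φ))))) ⟩
    ∑ (allMaps m n) (λ φ → + c * ⟦ embedsInto J G M φ ⟧)
      ≡⟨ ∑-*ˡ (+ c) (allMaps m n) _ ⟨
    + c * ∑ (allMaps m n) (λ φ → ⟦ embedsInto J G M φ ⟧)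
      ≡⟨ cong (+ c *_) (embeddings-count J G M) ⟩
    + c * (+ autCount J * + sInd J G M)
      ≡⟨ ℤP.*-assoc (+ c) (+ autCount J) (+ sInd J G M) ⟨
    (+ c * + autCount J) * + sInd J G M
      ≡⟨ trans (ℤP.pos-* (c ℕ.* autCount J) (sInd J G M)) (cong (_* + sInd J G M) (ℤP.pos-* c (autCount J))) ⟨
    + (c ℕ.* autCount J ℕ.* sInd J G M) ∎
    where
    open ≡-Reasoning
    c : ℕ
    c = 2 ℕ.^ (k ℕ.+ m)
    regroup : ∀ a b → a * (+ c * b) ≡ + c * (a * b)
    regroup a b = solve 3 (λ a d b → a :* (d :* b) := d :* (a :* b)) refl a (+ c) b

cancel-inverse : ∀ D s → 1 ℕ.≤ D → (+ s) / 1 ≡ invℕ D ℚ.* ((+ (D ℕ.* s)) / 1)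
cancel-inverse (suc d) s _ = toℚᵘ-injective (begin
  toℚᵘ ((+ s) / 1)                                    ≈⟨ toℚᵘ-fromℚᵘ (mkℚᵘ (+ s) 0) ⟩
  mkℚᵘ (+ s) 0                                         ≈⟨ *≡* cross-multiplied ⟨
  mkℚᵘ (+ 1) d ℚᵘ.* mkℚᵘ (+ (suc d ℕ.* s)) 0           ≈⟨ ℚᵘP.*-cong (toℚᵘ-fromℚᵘ (mkℚᵘ (+ 1) d))
                                                                      (toℚᵘ-fromℚᵘ (mkℚᵘ (+ (suc d ℕ.* s)) 0)) ⟨
  toℚᵘ (invℕ (suc d)) ℚᵘ.* toℚᵘ ((+ (suc d ℕ.* s)) / 1) ≈⟨ toℚᵘ-homo-* (invℕ (suc d)) ((+ (suc d ℕ.* s)) / 1) ⟨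
  toℚᵘ (invℕ (suc d) ℚ.* ((+ (suc d ℕ.* s)) / 1))      ∎)
  where
  open ℚᵘP.≃-Reasoning
  cross-multiplied : (+ 1 * + (suc d ℕ.* s)) * + 1 ≡ + s * (+ (suc d) * + 1)
  cross-multiplied = trans (cong (λ z → (+ 1 * z) * + 1) (ℤP.pos-* (suc d) s))
    (solve 2 (λ D x → (con (+ 1) :* (D :* x)) :* con (+ 1) := x :* (D :* con (+ 1))) refl (+ suc d) (+ s))

mainTheorem9 : ∀ {m n : ℕ} (J : Graph m) (G : Graph n) (w : Fin n) →
    (+ sInd J G (minusNbhd G w)) / 1 ≡ qTilde J (allBut w) (xG G) (λ u → xG G u w)
mainTheorem9 {m} J G w = begin
  (+ s) / 1                                     ≡⟨ cancel-inverse D s D-positive ⟩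
  invℕ D ℚ.* ((+ (D ℕ.* s)) / 1)                ≡⟨ cong (λ t → invℕ D ℚ.* (t / 1)) (≡-sym signedSum-value) ⟩
  qTilde J (allBut w) (xG G) (λ u → xG G u w)   ∎
  where
  open SignedSum J G w using (signedSum-value)
  open ≡-Reasoning
  s : ℕ
  s = sInd J G (minusNbhd G w)
  D : ℕ
  D = 2 ℕ.^ (length (edgesK m) ℕ.+ m) ℕ.* autCount J
  D-positive : 1 ℕ.≤ D
  D-positive = ℕP.*-mono-≤ (ℕP.m^n>0 2 (length (edgesK m) ℕ.+ m)) (autCount-positive J)
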